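{- Let $r$ be even, written as $r=2^{q}(2t+1)$ with integers $q\geq 1$, $t\geq 0$, and let $n\geq 2^{q}(2^{q}-1)r$. Then the maximum of $\chi(G)$ over all odd-colorable $r$-graphs $G$ on $n$ vertices equals $2^{q}$.
   Context: An $r$-graph $G=(V(G),E(G))$ is an $r$-uniform hypergraph: a finite vertex set together with a set of edges, each edge being a subset of $V(G)$ of exactly $r$ vertices. Write $[n]=\{1,\dots,n\}$. For even $r\geq 2$, an $r$-graph $G$ with $V(G)=[n]$ is called odd-colorable if there exists a map $\varphi:[n]\to[r]$ such that for every edge $\{j_1,\dots,j_r\}$ of $G$ one has $\varphi(j_1)+\cdots+\varphi(j_r)\equiv r/2 \pmod r$. An $r$-graph is $k$-chromatic if its vertex set can be partitioned into $k$ sets so that every edge intersects at least two of these sets; the chromatic number $\chi(G)$ is the smallest such $k$. -}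

module Defs where

open import Data.Nat using (ℕ; zero; suc; _+_; _*_; _≤_; ⌊_/2⌋)
open import Data.Bool using (Bool; true; false; if_then_else_)
open import Data.Fin using (Fin; toℕ)
open import Data.Fin.Subset using (Subset; _∈_; ∣_∣)
open import Data.Vec using (Vec; allFin; zipWith; sum)
open import Data.List using (List)
open import Data.List.Relation.Unary.All using (All)
open import Data.Product using (Σ; ∃; _×_)
open import Relation.Binary.PropositionalEquality using (_≡_; _≢_)

-- An r-graph on vertex set Fin n (vertex i corresponds to i+1 ∈ [n]):
-- a finite list of edges, each edge a subset of the vertices of size exactly r.
-- (Repetitions in the list are harmless: they describe the same edge set.)
record RGraph (r n : ℕ) : Set where
  field
    edges   : List (Subset n)
    uniform : All (λ e → ∣ e ∣ ≡ r) edges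
open RGraph public

-- Sum of (1 + toℕ (φ j)) over vertices j of the edge e.  A map Fin n → Fin r
-- with value c read as the colour c+1 ∈ [r].
edgeSum : ∀ {r n} → (Fin n → Fin r) → Subset n → ℕ
edgeSum {n = n} φ e =
  sum (zipWith (λ b j → if b then suc (toℕ (φ j)) else 0) e (allFin n))

CongHalf : ℕ → ℕ → Set
CongHalf r x = ∃ λ m → x ≡ m * r + ⌊ r /2⌋

OddColorable : ∀ {r n} → RGraph r n → Set
OddColorable {r} {n} G =
  Σ (Fin n → Fin r) λ φ → All (λ e → CongHalf r (edgeSum φ e)) (edges G)

Colorable : ∀ {r n} → RGraph r n → ℕ → Set
Colorable {n = n} G k =
  Σ (Fin n → Fin k) λ c →
    All (λ e → ∃ λ i → ∃ λ j → i ∈ e × j ∈ e × c i ≢ c j) (edges G)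

IsChromaticNumber : ∀ {r n} → RGraph r n → ℕ → Set
IsChromaticNumber G k = Colorable G k × (∀ j → Colorable G j → k ≤ j)

module Submission where

-- Write M = 2^q, so r = M(2t+1).  Reducing the colours of an odd colouring modulo M gives a
-- proper M-colouring: on an edge whose colours all agree modulo M the colour sum is
-- ≡ r·c ≡ 0 (mod M), whereas r/2 is an odd multiple of M/2.  For the lower bound take M
-- blocks of (M-1)r vertices, colour block a by 1 + a(2t+1), and make every r-set with
-- colour sum ≡ r/2 (mod r) an edge.  Given fewer than M colours, each block contains r
-- vertices of one colour and two blocks a < b share that colour; if k(b-a) ≡ M/2 (mod M),
-- then r-k of those vertices in block a and k in block b form a monochromatic edge.

open import Defs
open import Data.Nat
  using (ℕ; zero; suc; pred; _+_; _*_; _∸_; _^_; _≤_; _<_; z≤n; s≤s; _≟_; _≤?_; _<?_; ⌊_/2⌋;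
         NonZero; >-nonZero; >-nonZero⁻¹)
open import Data.Nat.Properties
open import Data.Nat.Divisibility using (divides; _∣?_)
open import Data.Nat.DivMod using (_divMod_; DivMod)
open import Data.Nat.Tactic.RingSolver using (solve-∀)
open import Data.Bool using (if_then_else_)
open import Data.Fin as Fin using (Fin; toℕ; fromℕ<; inject≤; combine; quotient)
  renaming (zero to 0F; suc to sucF)
open import Data.Fin.Properties
  using (toℕ-fromℕ<; toℕ<n; toℕ-injective; toℕ-inject≤; remQuot-combine; combine-injective;
         inject≤-injective; any?; pigeonhole)
  renaming (_≟_ to _≟F_; <⇒≢ to <⇒≢F)
open import Data.Fin.Subset using (Subset; inside; outside; _∈_; _∉_; ∣_∣; ⊥; ⁅_⁆; _∪_; Nonempty)
open import Data.Fin.Subset.Properties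
  using (x∈p∪q⁻; x∈⁅y⁆⇒x≡y; nonempty?; Empty-unique; ∣⊥∣≡0; ∉⊥; _∈?_)
open import Data.Vec using ([]; _∷_; here; there; tabulate; zipWith; sum)
open import Data.List as List using (List; map; length; filter; take; _++_)
open import Data.List.Properties
  using (length-take; length-++; length-map; length-tabulate; map-∘; map-++)
import Data.Nat.ListAction as ℕL
open import Data.Nat.ListAction.Properties using (sum-++)
open import Data.List.Membership.Propositional using () renaming (_∈_ to _∈ₗ_)
open import Data.List.Membership.Propositional.Properties
  using (∈-filter⁺; ∈-++⁺ˡ; ∈-++⁺ʳ; ∈-map⁺; ∈-map⁻)
open import Data.List.Relation.Unary.All as All using (All)
open import Data.List.Relation.Unary.All.Properties
  using (all-filter; take⁺; ++⁺) renaming (map⁺ to All-map⁺; filter⁺ to All-filter⁺)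
open import Data.List.Relation.Unary.Any using () renaming (here to hereₗ; there to thereₗ)
open import Data.List.Relation.Unary.Unique.Propositional using (Unique)
import Data.List.Relation.Unary.Unique.Propositional.Properties as Unique
open import Data.List.Relation.Unary.AllPairs using (_∷_)
open import Data.List.Relation.Binary.Sublist.Propositional.Properties
  using (length-mono-≤; filter-⊆) renaming (filter⁺ to Sublist-filter⁺)
open import Data.Sum using (_⊎_; inj₁; inj₂)
open import Data.Product using (Σ; ∃; ∃₂; _×_; _,_; proj₁; proj₂)
open import Function using (_∘_; const; id)
open import Level using (0ℓ)
open import Relation.Binary.PropositionalEquality
open import Relation.Nullary using (¬_; Dec; yes; no; ¬?; contradiction)
open import Relation.Nullary.Decidable using (_×-dec_; decidable-stable)
open import Relation.Unary using (Pred; Decidable)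
open import Algebra.Properties.CommutativeSemigroup +-commutativeSemigroup
  using (x∙yz≈y∙xz)

length-take-≤ : ∀ {A : Set} k (xs : List A) → k ≤ length xs → length (take k xs) ≡ k
length-take-≤ k xs k≤∣xs∣ = trans (length-take k xs) (m≤n⇒m⊓n≡m k≤∣xs∣)

sum-map-const : ∀ {A : Set} (f : A → ℕ) {c} → (∀ x → f x ≡ c) →
                ∀ xs → ℕL.sum (map f xs) ≡ length xs * c
sum-map-const f f≡c List.[]       = refl
sum-map-const f f≡c (x List.∷ xs) = cong₂ _+_ (f≡c x) (sum-map-const f f≡c xs)

length-filter+length-filter-∁ : ∀ {A : Set} {P : Pred A 0ℓ} (P? : Decidable P) xs →
  length (filter P? xs) + length (filter (¬? ∘ P?) xs) ≡ length xs
length-filter+length-filter-∁ P? List.[] = refl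
length-filter+length-filter-∁ P? (x List.∷ xs) with P? x
... | yes _ = cong suc (length-filter+length-filter-∁ P? xs)
... | no  _ = trans (+-suc _ _) (cong suc (length-filter+length-filter-∁ P? xs))

pigeonhole-filter : ∀ {A : Set} (f : A → ℕ) j k (xs : List A) → All (λ x → f x < j) xs →
  j * k < length xs → ∃ λ C → C < j × k < length (filter (λ x → f x ≟ C) xs)
pigeonhole-filter f zero k List.[]       _          ()
pigeonhole-filter f zero k (x List.∷ xs) (() All.∷ _) _
pigeonhole-filter f (suc j) k xs bounded large with k <? length (filter (λ x → f x ≟ j) xs)
... | yes big = j , n<1+n j , big
... | no ¬big =
  let C , C<j , big = pigeonhole-filter f j k rest bounded-rest large-rest
  in  C , m<n⇒m<1+n C<j , <-≤-trans big (length-mono-≤ (Sublist-filter⁺ _ _ (λ { refl → id }) (filter-⊆ _ xs)))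
  where
  rest : List _
  rest = filter (λ x → ¬? (f x ≟ j)) xs
  bounded-rest : All (λ x → f x < j) rest
  bounded-rest = All.zipWith (λ (fx<1+j , fx≢j) → ≤∧≢⇒< (≤-pred fx<1+j) fx≢j)
                             (All-filter⁺ _ bounded , all-filter _ xs)
  large-rest : j * k < length rest
  large-rest = +-cancelˡ-< k (j * k) (length rest) (<-≤-trans large (begin
    length xs                                           ≡⟨ length-filter+length-filter-∁ (λ x → f x ≟ j) xs ⟨
    length (filter (λ x → f x ≟ j) xs) + length rest   ≤⟨ +-monoˡ-≤ (length rest) (≮⇒≥ ¬big) ⟩
    k + length rest                                     ∎))
    where open ≤-Reasoning

weight : ∀ {n} → (Fin n → ℕ) → Subset n → ℕ
weight w []            = 0
weight w (inside  ∷ p) = w 0F + weight (w ∘ sucF) p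
weight w (outside ∷ p) = weight (w ∘ sucF) p

edgeSum≡weight : ∀ {r n} (φ : Fin n → Fin r) p → edgeSum φ p ≡ weight (suc ∘ toℕ ∘ φ) p
edgeSum≡weight φ p = sum-tabulate (suc ∘ toℕ ∘ φ) id p
  where
  sum-tabulate : ∀ {m n} (g : Fin m → ℕ) (h : Fin n → Fin m) p →
    sum (zipWith (λ b j → if b then g j else 0) p (tabulate h)) ≡ weight (g ∘ h) p
  sum-tabulate g h []            = refl
  sum-tabulate g h (inside  ∷ p) = cong (g (h 0F) +_) (sum-tabulate g (h ∘ sucF) p)
  sum-tabulate g h (outside ∷ p) = sum-tabulate g (h ∘ sucF) p

∣p∣≡weight1 : ∀ {n} (p : Subset n) → ∣ p ∣ ≡ weight (const 1) p
∣p∣≡weight1 []            = refl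
∣p∣≡weight1 (inside  ∷ p) = cong suc (∣p∣≡weight1 p)
∣p∣≡weight1 (outside ∷ p) = ∣p∣≡weight1 p

weight-⊥ : ∀ {n} (w : Fin n → ℕ) → weight w ⊥ ≡ 0
weight-⊥ {zero}  w = refl
weight-⊥ {suc n} w = weight-⊥ (w ∘ sucF)

weight-⁅⁆ : ∀ {n} (w : Fin n → ℕ) x → weight w ⁅ x ⁆ ≡ w x
weight-⁅⁆ w 0F       = trans (cong (w 0F +_) (weight-⊥ (w ∘ sucF))) (+-identityʳ (w 0F))
weight-⁅⁆ w (sucF x) = weight-⁅⁆ (w ∘ sucF) x

weight-∪ : ∀ {n} (w : Fin n → ℕ) (p q : Subset n) → (∀ {x} → x ∈ p → x ∉ q) →
           weight w (p ∪ q) ≡ weight w p + weight w q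
weight-∪ w []            []            _ = refl
weight-∪ w (inside  ∷ p) (inside  ∷ q) disj = contradiction here (disj here)
weight-∪ w (inside  ∷ p) (outside ∷ q) disj =
  trans (cong (w 0F +_) (weight-∪ (w ∘ sucF) p q (λ x∈p → disj (there x∈p) ∘ there)))
        (sym (+-assoc (w 0F) _ _))
weight-∪ w (outside ∷ p) (inside  ∷ q) disj =
  trans (cong (w 0F +_) (weight-∪ (w ∘ sucF) p q (λ x∈p → disj (there x∈p) ∘ there)))
        (x∙yz≈y∙xz (w 0F) (weight (w ∘ sucF) p) (weight (w ∘ sucF) q))
weight-∪ w (outside ∷ p) (outside ∷ q) disj =
  weight-∪ (w ∘ sucF) p q (λ x∈p → disj (there x∈p) ∘ there)

weight-affine : ∀ {n} (w g : Fin n → ℕ) (c M : ℕ) (p : Subset n) →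
                (∀ {x} → x ∈ p → w x ≡ c + g x * M) →
                weight w p ≡ ∣ p ∣ * c + weight g p * M
weight-affine w g c M []            _  = refl
weight-affine w g c M (inside  ∷ p) on = begin
  w 0F + weight (w ∘ sucF) p
    ≡⟨ cong₂ _+_ (on here) (weight-affine (w ∘ sucF) (g ∘ sucF) c M p (on ∘ there)) ⟩
  (c + g 0F * M) + (∣ p ∣ * c + weight (g ∘ sucF) p * M)
    ≡⟨ regroup c M (g 0F) ∣ p ∣ (weight (g ∘ sucF) p) ⟩
  suc ∣ p ∣ * c + (g 0F + weight (g ∘ sucF) p) * M ∎
  where
  open ≡-Reasoning
  regroup : ∀ c M x k y → (c + x * M) + (k * c + y * M) ≡ suc k * c + (x + y) * M
  regroup = solve-∀
weight-affine w g c M (outside ∷ p) on = weight-affine (w ∘ sucF) (g ∘ sucF) c M p (on ∘ there)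

nonempty : ∀ {n} (p : Subset n) → 0 < ∣ p ∣ → Nonempty p
nonempty {n} p 0<∣p∣ with nonempty? p
... | yes ne  = ne
... | no  ¬ne = contradiction (trans (cong ∣_∣ (Empty-unique ¬ne)) (∣⊥∣≡0 n)) (>⇒≢ 0<∣p∣)

fromList : ∀ {n} → List (Fin n) → Subset n
fromList = List.foldr (λ x p → ⁅ x ⁆ ∪ p) ⊥

∈-fromList⁻ : ∀ {n} {x : Fin n} xs → x ∈ fromList xs → x ∈ₗ xs
∈-fromList⁻ List.[]       x∈⊥ = contradiction x∈⊥ ∉⊥
∈-fromList⁻ (y List.∷ ys) x∈p with x∈p∪q⁻ ⁅ y ⁆ (fromList ys) x∈p
... | inj₁ x∈⁅y⁆ = hereₗ (x∈⁅y⁆⇒x≡y y x∈⁅y⁆)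
... | inj₂ x∈ys  = thereₗ (∈-fromList⁻ ys x∈ys)

weight-fromList : ∀ {n} (w : Fin n → ℕ) xs → Unique xs → weight w (fromList xs) ≡ ℕL.sum (map w xs)
weight-fromList w List.[]       _ = weight-⊥ w
weight-fromList w (y List.∷ ys) (y∉ys ∷ uniq) =
  trans (weight-∪ w ⁅ y ⁆ (fromList ys) disjoint)
        (cong₂ _+_ (weight-⁅⁆ w y) (weight-fromList w ys uniq))
  where
  disjoint : ∀ {x} → x ∈ ⁅ y ⁆ → x ∉ fromList ys
  disjoint x∈⁅y⁆ x∈ys with refl ← x∈⁅y⁆⇒x≡y y x∈⁅y⁆ =
    All.lookup y∉ys (∈-fromList⁻ ys x∈ys) refl

∣fromList∣ : ∀ {n} (xs : List (Fin n)) → Unique xs → ∣ fromList xs ∣ ≡ length xs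
∣fromList∣ xs uniq = begin
  ∣ fromList xs ∣                  ≡⟨ ∣p∣≡weight1 (fromList xs) ⟩
  weight (const 1) (fromList xs)   ≡⟨ weight-fromList (const 1) xs uniq ⟩
  ℕL.sum (map (const 1) xs)        ≡⟨ sum-map-const (const 1) (λ _ → refl) xs ⟩
  length xs * 1                    ≡⟨ *-identityʳ (length xs) ⟩
  length xs                        ∎
  where open ≡-Reasoning

2t+1≢0 : ∀ t → NonZero (2 * t + 1)
2t+1≢0 t = subst NonZero (+-comm 1 (2 * t)) _

⌊2*n/2⌋≡n : ∀ n → ⌊ 2 * n /2⌋ ≡ n
⌊2*n/2⌋≡n n = sym (trans (n≡⌊n+n/2⌋ n) (cong (λ k → ⌊ n + k /2⌋) (sym (+-identityʳ n))))

⌊2*h*m/2⌋≡h*m : ∀ h m → ⌊ 2 * h * m /2⌋ ≡ h * m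
⌊2*h*m/2⌋≡h*m h m = trans (cong ⌊_/2⌋ (*-assoc 2 h m)) (⌊2*n/2⌋≡n (h * m))

-- r/2 = h(2t+1) is an odd multiple of h, while a multiple of 2h is an even one.
¬CongHalf-*2h : ∀ h t .{{_ : NonZero h}} x → ¬ CongHalf (2 * h * (2 * t + 1)) (x * (2 * h))
¬CongHalf-*2h h t x (X , eq) = even≢odd x (X * m + t) (*-cancelˡ-≡ _ _ h (begin
  h * (2 * x)                ≡⟨ swap h x ⟩
  x * (2 * h)                ≡⟨ eq ⟩
  X * r + ⌊ r /2⌋            ≡⟨ cong (X * r +_) (⌊2*h*m/2⌋≡h*m h m) ⟩
  X * r + h * m              ≡⟨ factor X h t ⟩
  h * suc (2 * (X * m + t))  ∎))
  where
  open ≡-Reasoning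
  m = 2 * t + 1
  r = 2 * h * m
  swap : ∀ h x → h * (2 * x) ≡ x * (2 * h)
  swap = solve-∀
  factor : ∀ X h t → X * (2 * h * (2 * t + 1)) + h * (2 * t + 1) ≡ h * suc (2 * (X * (2 * t + 1) + t))
  factor = solve-∀

congHalf-across : ∀ h t x y k J → let m = 2 * t + 1; r = 2 * h * m in
  x ≤ y → k ≤ r → k * (y ∸ x) ≡ J * (2 * h) + h → CongHalf r ((r ∸ k) * suc (x * m) + k * suc (y * m))
congHalf-across h t x y k J x≤y k≤r k*d≡ = s + J , (begin
  (r ∸ k) * s + k * suc (y * m)           ≡⟨ cong (λ z → (r ∸ k) * s + k * suc (z * m)) (m+[n∸m]≡n x≤y) ⟨
  (r ∸ k) * s + k * suc ((x + d) * m)     ≡⟨ expand (r ∸ k) k x d m ⟩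
  (r ∸ k + k) * s + k * d * m             ≡⟨ cong₂ (λ u v → u * s + v * m) (m∸n+n≡m k≤r) k*d≡ ⟩
  r * s + (J * (2 * h) + h) * m           ≡⟨ collect h t x J ⟩
  (s + J) * r + h * m                     ≡⟨ cong ((s + J) * r +_) (⌊2*h*m/2⌋≡h*m h m) ⟨
  (s + J) * r + ⌊ r /2⌋                   ∎)
  where
  open ≡-Reasoning
  m = 2 * t + 1
  r = 2 * h * m
  d = y ∸ x
  s = suc (x * m)
  expand : ∀ u k x d m → u * suc (x * m) + k * suc ((x + d) * m) ≡ (u + k) * suc (x * m) + k * d * m
  expand = solve-∀
  collect : ∀ h t x J → let m = 2 * t + 1 in
    2 * h * m * suc (x * m) + (J * (2 * h) + h) * m ≡ (suc (x * m) + J) * (2 * h * m) + h * m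
  collect = solve-∀

even-or-odd : ∀ d → ∃ λ h → d ≡ 2 * h ⊎ d ≡ suc (2 * h)
even-or-odd zero = 0 , inj₁ refl
even-or-odd (suc d) with even-or-odd d
... | h , inj₁ refl = h , inj₂ refl
... | h , inj₂ refl = suc h , inj₁ (cong suc (sym (+-suc h (h + 0))))

-- Write d = 2^s·(odd); then k = 2^(p-s) works.
∃k*d≡2^p : ∀ p d → 0 < d → d < 2 ^ suc p →
           ∃₂ λ k J → k < 2 ^ suc p × k * d ≡ J * 2 ^ suc p + 2 ^ p
∃k*d≡2^p p d 0<d d<2^[1+p] with even-or-odd d
... | h , inj₂ refl = 2 ^ p , h , n<2*n (2 ^ p) {{m^n≢0 2 p}} , odd h (2 ^ p)
  where
  n<2*n : ∀ n .{{_ : NonZero n}} → n < 2 * n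
  n<2*n n = subst (n <_) (*-comm n 2) (m<m*n n 2 (s≤s (s≤s z≤n)))
  odd : ∀ h P → P * suc (2 * h) ≡ h * (2 * P) + P
  odd = solve-∀
∃k*d≡2^p zero     d 0<d d<2 | zero  , inj₁ refl = contradiction 0<d (λ ())
∃k*d≡2^p zero     d 0<d d<2 | suc h , inj₁ refl = contradiction d<2 (≤⇒≯ (*-monoʳ-≤ 2 (s≤s z≤n)))
∃k*d≡2^p (suc p) d 0<d d<2^[2+p] | h , inj₁ refl =
  let k , J , k<2^[1+p] , k*h≡ = ∃k*d≡2^p p h 0<h (*-cancelˡ-< 2 h (2 ^ suc p) d<2^[2+p])
  in  k , J , <-≤-trans k<2^[1+p] (m≤n*m (2 ^ suc p) 2) , double k h J (2 ^ suc p) (2 ^ p) k*h≡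
  where
  0<h : 0 < h
  0<h = n≢0⇒n>0 λ { refl → <-irrefl refl 0<d }
  double : ∀ k h J P Q → k * h ≡ J * P + Q → k * (2 * h) ≡ J * (2 * P) + 2 * Q
  double k h J P Q eq = trans (pull-2 k h) (trans (cong (2 *_) eq) (push-2 J P Q))
    where
    pull-2 : ∀ k h → k * (2 * h) ≡ 2 * (k * h)
    pull-2 = solve-∀
    push-2 : ∀ J P Q → 2 * (J * P + Q) ≡ J * (2 * P) + 2 * Q
    push-2 = solve-∀

-- The largest r-graph odd-coloured by a given colouring

allSubsets : ∀ n → List (Subset n)
allSubsets zero    = [] List.∷ List.[]
allSubsets (suc n) = map (inside ∷_) (allSubsets n) ++ map (outside ∷_) (allSubsets n)

∈-allSubsets : ∀ {n} (p : Subset n) → p ∈ₗ allSubsets n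
∈-allSubsets []                    = hereₗ refl
∈-allSubsets (inside  ∷ p)         = ∈-++⁺ˡ (∈-map⁺ (inside ∷_) (∈-allSubsets p))
∈-allSubsets {suc n} (outside ∷ p) =
  ∈-++⁺ʳ (map (inside ∷_) (allSubsets n)) (∈-map⁺ (outside ∷_) (∈-allSubsets p))

congHalf? : ∀ r x → Dec (CongHalf r x)
congHalf? r x with ⌊ r /2⌋ ≤? x | r ∣? (x ∸ ⌊ r /2⌋)
... | yes r/2≤x | yes (divides X eq) = yes (X , trans (sym (m∸n+n≡m r/2≤x)) (cong (_+ ⌊ r /2⌋) eq))
... | no  r/2≰x | _                  = no λ (X , eq) → r/2≰x (subst (⌊ r /2⌋ ≤_) (sym eq) (m≤n+m _ _))
... | yes _     | no  r∤x-r/2        = no λ (X , eq) →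
  r∤x-r/2 (divides X (trans (cong (_∸ ⌊ r /2⌋) eq) (m+n∸n≡m (X * r) ⌊ r /2⌋)))

module _ {r n} (φ : Fin n → Fin r) where

  IsOddEdge : Subset n → Set
  IsOddEdge e = ∣ e ∣ ≡ r × CongHalf r (edgeSum φ e)

  isOddEdge? : Decidable IsOddEdge
  isOddEdge? e = (∣ e ∣ ≟ r) ×-dec congHalf? r (edgeSum φ e)

  oddGraph : RGraph r n
  oddGraph = record
    { edges   = filter isOddEdge? (allSubsets n)
    ; uniform = All.map proj₁ (all-filter isOddEdge? (allSubsets n))
    }

  oddGraph-oddColorable : OddColorable oddGraph
  oddGraph-oddColorable = φ , All.map proj₂ (all-filter isOddEdge? (allSubsets n))

  ∈-oddGraph : ∀ {e} → IsOddEdge e → e ∈ₗ edges oddGraph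
  ∈-oddGraph {e} = ∈-filter⁺ isOddEdge? (∈-allSubsets e)

-- Upper bound: colour each vertex by its odd colour modulo 2h

module _ (h t : ℕ) .{{_ : NonZero h}} {n} (φ : Fin n → Fin (2 * h * (2 * t + 1))) where

  private
    instance
      2h≢0 : NonZero (2 * h)
      2h≢0 = m*n≢0 2 h
      r≢0 : NonZero (2 * h * (2 * t + 1))
      r≢0 = m*n≢0 (2 * h) (2 * t + 1) {{2h≢0}} {{2t+1≢0 t}}

  residue : Fin n → Fin (2 * h)
  residue v = DivMod.remainder (suc (toℕ (φ v)) divMod (2 * h))

  oddEdge-bichromatic : ∀ e → IsOddEdge φ e → ∃₂ λ x y → x ∈ e × y ∈ e × residue x ≢ residue y
  oddEdge-bichromatic e (∣e∣≡r , half)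
    with x , x∈e ← nonempty e (subst (0 <_) (sym ∣e∣≡r) (>-nonZero⁻¹ (2 * h * (2 * t + 1))))
    with any? (λ y → (y ∈? e) ×-dec ¬? (residue y ≟F residue x))
  ... | yes (y , y∈e , ry≢rx) = y , x , y∈e , x∈e , ry≢rx
  ... | no  monochromatic     =
    contradiction (subst (CongHalf (2 * h * (2 * t + 1))) edgeSum≡multiple half)
                  (¬CongHalf-*2h h t ((2 * t + 1) * c + weight q e))
    where
    w : Fin n → ℕ
    w v = suc (toℕ (φ v))
    c = toℕ (residue x)
    q : Fin n → ℕ
    q v = DivMod.quotient (w v divMod (2 * h))
    w≡c+q*2h : ∀ {y} → y ∈ e → w y ≡ c + q y * (2 * h)
    w≡c+q*2h {y} y∈e = trans (DivMod.property (w y divMod (2 * h)))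
      (cong (λ z → toℕ z + q y * (2 * h))
            (decidable-stable (residue y ≟F residue x) (λ ry≢rx → monochromatic (y , y∈e , ry≢rx))))
    edgeSum≡multiple : edgeSum φ e ≡ ((2 * t + 1) * c + weight q e) * (2 * h)
    edgeSum≡multiple = begin
      edgeSum φ e                                      ≡⟨ edgeSum≡weight φ e ⟩
      weight w e                                       ≡⟨ weight-affine w q c (2 * h) e w≡c+q*2h ⟩
      ∣ e ∣ * c + weight q e * (2 * h)
        ≡⟨ cong (λ k → k * c + weight q e * (2 * h)) ∣e∣≡r ⟩
      2 * h * (2 * t + 1) * c + weight q e * (2 * h)   ≡⟨ factor h t c (weight q e) ⟩
      ((2 * t + 1) * c + weight q e) * (2 * h)         ∎
      where
      open ≡-Reasoning
      factor : ∀ h t c Q → 2 * h * (2 * t + 1) * c + Q * (2 * h) ≡ ((2 * t + 1) * c + Q) * (2 * h)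
      factor = solve-∀

oddColorable⇒colorable : ∀ h t .{{_ : NonZero h}} {n} (G : RGraph (2 * h * (2 * t + 1)) n) →
                         OddColorable G → Colorable G (2 * h)
oddColorable⇒colorable h t G (φ , odd) =
  residue h t φ , All.zipWith (λ {e} → oddEdge-bichromatic h t φ e) (uniform G , odd)

-- Lower bound: M = 2^(p+1) blocks of B vertices, block a odd-coloured by 1 + a(2t+1)

module BlowUp (p t n : ℕ) (n-large : 2 ^ suc p * (2 ^ suc p ∸ 1) * (2 ^ suc p * (2 * t + 1)) ≤ n) where

  M m r B : ℕ
  M = 2 ^ suc p
  m = 2 * t + 1
  r = M * m
  B = (M ∸ 1) * r

  private
    instance
      M≢0 : NonZero M
      M≢0 = m^n≢0 2 (suc p)
      m≢0 : NonZero m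
      m≢0 = 2t+1≢0 t
      r≢0 : NonZero r
      r≢0 = m*n≢0 M m

  MB≤n : M * B ≤ n
  MB≤n = subst (_≤ n) (*-assoc M (M ∸ 1) r) n-large

  vertex : Fin M → Fin B → Fin n
  vertex a i = inject≤ (combine a i) MB≤n

  vertex-injective : ∀ {a b i j} → vertex a i ≡ vertex b j → a ≡ b × i ≡ j
  vertex-injective {a} {b} {i} {j} eq = combine-injective a i b j (inject≤-injective MB≤n MB≤n _ _ eq)

  class : Fin n → Fin M
  class v with toℕ v <? M * B
  ... | yes v<MB = quotient B (fromℕ< v<MB)
  ... | no  _    = fromℕ< (>-nonZero⁻¹ M)

  class-vertex : ∀ a i → class (vertex a i) ≡ a
  class-vertex a i with toℕ (vertex a i) <? M * B
  ... | yes v<MB =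
    trans (cong (quotient B) (toℕ-injective (trans (toℕ-fromℕ< v<MB) (toℕ-inject≤ (combine a i) MB≤n))))
          (cong proj₁ (remQuot-combine a i))
  ... | no  v≮MB =
    contradiction (subst (_< M * B) (sym (toℕ-inject≤ (combine a i) MB≤n)) (toℕ<n (combine a i))) v≮MB

  φ : Fin n → Fin r
  φ v = fromℕ< (*-monoˡ-< m (toℕ<n (class v)))

  φ-vertex : ∀ a i → suc (toℕ (φ (vertex a i))) ≡ suc (toℕ a * m)
  φ-vertex a i = cong suc (trans (toℕ-fromℕ< _) (cong (λ b → toℕ b * m) (class-vertex a i)))

  G : RGraph r n
  G = oddGraph φ

  across : Fin M → Fin M → List (Fin B) → List (Fin B) → List (Fin n)
  across a b xs ys = map (vertex a) xs ++ map (vertex b) ys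

  across-unique : ∀ {a b xs ys} → a ≢ b → Unique xs → Unique ys → Unique (across a b xs ys)
  across-unique {a} {b} {xs} {ys} a≢b xs! ys! =
    Unique.++⁺ (Unique.map⁺ (proj₂ ∘ vertex-injective) xs!) (Unique.map⁺ (proj₂ ∘ vertex-injective) ys!)
               disjoint
    where
    disjoint : ∀ {v} → ¬ (v ∈ₗ map (vertex a) xs × v ∈ₗ map (vertex b) ys)
    disjoint (v∈xs , v∈ys)
      with _ , _ , refl ← ∈-map⁻ (vertex a) v∈xs | _ , _ , eq ← ∈-map⁻ (vertex b) v∈ys =
      a≢b (proj₁ (vertex-injective eq))

  ∣across∣ : ∀ {a b} xs ys → Unique (across a b xs ys) →
             ∣ fromList (across a b xs ys) ∣ ≡ length xs + length ys
  ∣across∣ {a} {b} xs ys uniq = begin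
    ∣ fromList (across a b xs ys) ∣              ≡⟨ ∣fromList∣ (across a b xs ys) uniq ⟩
    length (map (vertex a) xs ++ map (vertex b) ys) ≡⟨ length-++ (map (vertex a) xs) ⟩
    length (map (vertex a) xs) + length (map (vertex b) ys)
      ≡⟨ cong₂ _+_ (length-map (vertex a) xs) (length-map (vertex b) ys) ⟩
    length xs + length ys                       ∎
    where open ≡-Reasoning

  edgeSum-across : ∀ {a b} xs ys → Unique (across a b xs ys) →
    edgeSum φ (fromList (across a b xs ys)) ≡ length xs * suc (toℕ a * m) + length ys * suc (toℕ b * m)
  edgeSum-across {a} {b} xs ys uniq = begin
    edgeSum φ (fromList (across a b xs ys))
      ≡⟨ edgeSum≡weight φ (fromList (across a b xs ys)) ⟩
    weight w (fromList (across a b xs ys))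
      ≡⟨ weight-fromList w (across a b xs ys) uniq ⟩
    ℕL.sum (map w (map (vertex a) xs ++ map (vertex b) ys))
      ≡⟨ cong ℕL.sum (map-++ w (map (vertex a) xs) (map (vertex b) ys)) ⟩
    ℕL.sum (map w (map (vertex a) xs) ++ map w (map (vertex b) ys))
      ≡⟨ sum-++ (map w (map (vertex a) xs)) _ ⟩
    ℕL.sum (map w (map (vertex a) xs)) + ℕL.sum (map w (map (vertex b) ys))
      ≡⟨ cong₂ _+_ (sum-block a xs) (sum-block b ys) ⟩
    length xs * suc (toℕ a * m) + length ys * suc (toℕ b * m) ∎
    where
    open ≡-Reasoning
    w : Fin n → ℕ
    w = suc ∘ toℕ ∘ φ
    sum-block : ∀ a xs → ℕL.sum (map w (map (vertex a) xs)) ≡ length xs * suc (toℕ a * m)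
    sum-block a xs = trans (cong ℕL.sum (sym (map-∘ xs))) (sum-map-const (w ∘ vertex a) (φ-vertex a) xs)

  -- With k(b - a) ≡ M/2 (mod M), taking r - k vertices of block a and k of block b
  -- gives colour sum ≡ r/2 (mod r).
  edgeAcross : ∀ {a b} → a Fin.< b → (P : Pred (Fin n) 0ℓ) {xs ys : List (Fin B)} →
    Unique xs → Unique ys → r ≤ length xs → r ≤ length ys →
    All (P ∘ vertex a) xs → All (P ∘ vertex b) ys →
    ∃ λ e → e ∈ₗ edges G × (∀ {v} → v ∈ e → P v)
  edgeAcross {a} {b} a<b P {xs} {ys} xs! ys! r≤∣xs∣ r≤∣ys∣ Pxs Pys
    with k , J , k<M , k*d≡ ← ∃k*d≡2^p p (toℕ b ∸ toℕ a) (m<n⇒0<n∸m a<b)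
                                  (≤-<-trans (m∸n≤m (toℕ b) (toℕ a)) (toℕ<n b)) =
    fromList vs , ∈-oddGraph φ (∣e∣≡r , half) ,
    λ v∈e → All.lookup (++⁺ (All-map⁺ (take⁺ (r ∸ k) Pxs)) (All-map⁺ (take⁺ k Pys)))
                       (∈-fromList⁻ vs v∈e)
    where
    xs′ ys′ : List (Fin B)
    xs′ = take (r ∸ k) xs
    ys′ = take k ys
    vs : List (Fin n)
    vs = across a b xs′ ys′
    k≤r : k ≤ r
    k≤r = ≤-trans (<⇒≤ k<M) (m≤m*n M m)
    ∣xs′∣ : length xs′ ≡ r ∸ k
    ∣xs′∣ = length-take-≤ (r ∸ k) xs (≤-trans (m∸n≤m r k) r≤∣xs∣)
    ∣ys′∣ : length ys′ ≡ k
    ∣ys′∣ = length-take-≤ k ys (≤-trans k≤r r≤∣ys∣)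
    vs! : Unique vs
    vs! = across-unique (<⇒≢F a<b) (Unique.take⁺ (r ∸ k) xs!) (Unique.take⁺ k ys!)
    ∣e∣≡r : ∣ fromList vs ∣ ≡ r
    ∣e∣≡r = trans (∣across∣ xs′ ys′ vs!) (trans (cong₂ _+_ ∣xs′∣ ∣ys′∣) (m∸n+n≡m k≤r))
    half : CongHalf r (edgeSum φ (fromList vs))
    half = subst (CongHalf r)
      (sym (trans (edgeSum-across xs′ ys′ vs!)
                  (cong₂ (λ u v → u * suc (toℕ a * m) + v * suc (toℕ b * m)) ∣xs′∣ ∣ys′∣)))
      (congHalf-across (2 ^ p) t (toℕ a) (toℕ b) k J (<⇒≤ a<b) k≤r k*d≡)

  module _ {j} (c : Fin n → Fin j) (j<M : j < M) where

    colourClass : Fin M → ℕ → List (Fin B)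
    colourClass a C = filter (λ i → toℕ (c (vertex a i)) ≟ C) (List.allFin B)

    large-colourClass : ∀ a → ∃ λ C → C < j × r ≤ length (colourClass a C)
    large-colourClass a =
      let C , C<j , pred[r]<∣class∣ =
            pigeonhole-filter (toℕ ∘ c ∘ vertex a) j (pred r) (List.allFin B)
                              (All.tabulate λ _ → toℕ<n _) j*pred[r]<B
      in  C , C<j , subst (_≤ length (colourClass a C)) (suc-pred r) pred[r]<∣class∣
      where
      M∸1≢0 : NonZero (M ∸ 1)
      M∸1≢0 = >-nonZero (m<n⇒0<n∸m (*-monoʳ-≤ 2 (m^n>0 2 p)))
      j*pred[r]<B : j * pred r < length (List.allFin B)
      j*pred[r]<B = begin-strict
        j * pred r          ≤⟨ *-monoˡ-≤ (pred r) (∸-monoˡ-≤ 1 j<M) ⟩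
        (M ∸ 1) * pred r    <⟨ *-monoʳ-< (M ∸ 1) {{M∸1≢0}} (subst (pred r <_) (suc-pred r) (n<1+n (pred r))) ⟩
        B                   ≡⟨ length-tabulate id ⟨
        length (List.allFin B) ∎
        where open ≤-Reasoning

    dominant : Fin M → Fin j
    dominant a = fromℕ< (proj₁ (proj₂ (large-colourClass a)))

    large-dominant : ∀ a → r ≤ length (colourClass a (toℕ (dominant a)))
    large-dominant a =
      subst (λ C → r ≤ length (colourClass a C)) (sym (toℕ-fromℕ< _)) (proj₂ (proj₂ (large-colourClass a)))

    monochromaticEdge : ∀ {a b C} → a Fin.< b → r ≤ length (colourClass a C) → r ≤ length (colourClass b C) →
                        ∃ λ e → e ∈ₗ edges G × (∀ {v} → v ∈ e → toℕ (c v) ≡ C)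
    monochromaticEdge {a} {b} {C} a<b r≤∣a∣ r≤∣b∣ =
      edgeAcross a<b (λ v → toℕ (c v) ≡ C)
                 (Unique.filter⁺ _ (Unique.allFin⁺ B)) (Unique.filter⁺ _ (Unique.allFin⁺ B))
                 r≤∣a∣ r≤∣b∣ (all-filter (λ i → toℕ (c (vertex a i)) ≟ C) (List.allFin B))
                             (all-filter (λ i → toℕ (c (vertex b i)) ≟ C) (List.allFin B))

  ¬colorable : ∀ j → j < M → ¬ Colorable G j
  ¬colorable j j<M (c , proper) with a , b , a<b , same ← pigeonhole j<M (dominant c j<M) =
    let e , e∈G , e⊆C = monochromaticEdge c j<M a<b (large-dominant c j<M a)
                          (subst (λ D → r ≤ length (colourClass c j<M b (toℕ D))) (sym same) (large-dominant c j<M b))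
        x , y , x∈e , y∈e , cx≢cy = All.lookup proper e∈G
    in  cx≢cy (toℕ-injective (trans (e⊆C x∈e) (sym (e⊆C y∈e))))

  chromatic : IsChromaticNumber G M
  chromatic = oddColorable⇒colorable (2 ^ p) t {{m^n≢0 2 p}} G (oddGraph-oddColorable φ) ,
              λ j colorable → ≮⇒≥ (λ j<M → ¬colorable j j<M colorable)

mainTheorem3 : (q t : ℕ) → 1 ≤ q →
    (n : ℕ) → (2 ^ q) * (2 ^ q ∸ 1) * ((2 ^ q) * (2 * t + 1)) ≤ n →
    ((G : RGraph ((2 ^ q) * (2 * t + 1)) n) → OddColorable G →
      (k : ℕ) → IsChromaticNumber G k → k ≤ 2 ^ q)
    × Σ (RGraph ((2 ^ q) * (2 * t + 1)) n) (λ G → OddColorable G × IsChromaticNumber G (2 ^ q))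
mainTheorem3 zero    t () n n-large
mainTheorem3 (suc p) t _  n n-large =
  (λ G odd k (_ , minimal) → minimal (2 ^ suc p) (oddColorable⇒colorable (2 ^ p) t {{m^n≢0 2 p}} G odd)) ,
  (G , oddGraph-oddColorable φ , chromatic)
  where open BlowUp p t n n-large
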